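{- Let $S=\{s_1,\dots,s_k\}$ be a set of service centers, $D$ a set of demand units, and $\mathcal{CM}:D\times S\to\mathbb{Z}_{>0}$ a cost matrix. Let $\mathcal{A}1$ be an allotment such that the allotment subspace multigraph $\Gamma(\mathcal{A}1)$ has no directed cycle of negative total cost. Let $d_i\in D$ be a demand unit not allotted in $\mathcal{A}1$, let $s_j\in S$, and let $\mathcal{A}2=\mathcal{A}1\cup\{\langle d_i,s_j\rangle\}$. Let $C_{min}$ be a simple directed cycle in $\Gamma(\mathcal{A}2)$ passing through $s_j$ whose total cost is minimum among all simple directed cycles of $\Gamma(\mathcal{A}2)$ passing through $s_j$. If the cost of $C_{min}$ is negative, let $\mathcal{A}3$ be obtained from $\mathcal{A}2$ by performing the transfers of all edges of $C_{min}$; otherwise let $\mathcal{A}3=\mathcal{A}2$. Then $\Gamma(\mathcal{A}3)$ has no directed cycle of negative total cost.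
   Context: An allotment is a set of pairs $\langle d,s\rangle$ with $d\in D$, $s\in S$, in which each demand unit appears in at most one pair (meaning $d$ is allotted to $s$). For an allotment $\mathcal{A}$, the allotment subspace multigraph $\Gamma(\mathcal{A})$ is the directed multigraph whose vertex set is $S$ and which, for every pair $\langle d,s_p\rangle\in\mathcal{A}$ and every $s_q\in S$ with $s_q\neq s_p$, contains a directed edge $(s_p,s_q,d)$ from $s_p$ to $s_q$ (representing the transfer of $d$ from $s_p$ to $s_q$) of cost $\mathcal{CM}(d,s_q)-\mathcal{CM}(d,s_p)$. The cost of a cycle or path is the sum of its edge costs. Performing the transfer of an edge $(s_p,s_q,d)$ means replacing $\langle d,s_p\rangle$ by $\langle d,s_q\rangle$ in the allotment; in a simple cycle all edges have distinct tails and hence move distinct demand units, and all these transfers are performed (with respect to the allotment before any of them). -}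

module Defs where

open import Data.Nat using (ℕ)
open import Data.Fin using (Fin; _≟_)
open import Data.Maybe using (Maybe; just; nothing)
open import Data.Integer using (ℤ; +_; _-_; _+_; _<?_; 0ℤ)
open import Data.List using (List; []; _∷_; map; foldr)
open import Data.List.Relation.Unary.All using (All)
open import Data.List.Relation.Unary.Any using (Any)
open import Data.List.Relation.Unary.Unique.Propositional using (Unique)
open import Data.Product using (_×_)
open import Data.Empty using (⊥)
open import Relation.Binary.PropositionalEquality using (_≡_; _≢_)
open import Relation.Nullary using (does)
open import Data.Bool using (if_then_else_)

-- Demand units D = Fin m, service centers S = Fin k.
-- Cost matrix CM : D × S → ℤ_{>0}, represented by ℕ-valued matrix (positivity is a separate hypothesis).
CostMatrix : ℕ → ℕ → Set
CostMatrix m k = Fin m → Fin k → ℕ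

-- An allotment: a set of pairs ⟨d,s⟩ with each d in at most one pair,
-- i.e. a partial function D → S (nothing = d not allotted).
Allotment : ℕ → ℕ → Set
Allotment m k = Fin m → Maybe (Fin k)

extend : ∀ {m k} → Allotment m k → Fin m → Fin k → Allotment m k
extend A d s d' = if does (d' ≟ d) then just s else A d'

record Edge (m k : ℕ) : Set where
  constructor edge
  field
    tail : Fin k
    head : Fin k
    dem  : Fin m
open Edge public

IsEdge : ∀ {m k} → Allotment m k → Edge m k → Set
IsEdge A e = (A (dem e) ≡ just (tail e)) × (head e ≢ tail e)

edgeCost : ∀ {m k} → CostMatrix m k → Edge m k → ℤ
edgeCost CM e = + CM (dem e) (head e) - + CM (dem e) (tail e)

pathCost : ∀ {m k} → CostMatrix m k → List (Edge m k) → ℤ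
pathCost CM es = foldr (λ e z → edgeCost CM e + z) 0ℤ es

IsWalk : ∀ {m k} → Fin k → List (Edge m k) → Fin k → Set
IsWalk u [] v = u ≡ v
IsWalk u (e ∷ es) v = (tail e ≡ u) × IsWalk (head e) es v

IsSimpleCycle : ∀ {m k} → Allotment m k → List (Edge m k) → Set
IsSimpleCycle A [] = ⊥
IsSimpleCycle A (e ∷ es) =
  All (IsEdge A) (e ∷ es) × IsWalk (tail e) (e ∷ es) (tail e) × Unique (map tail (e ∷ es))

PassesThrough : ∀ {m k} → Fin k → List (Edge m k) → Set
PassesThrough s es = Any (λ e → tail e ≡ s) es

NoNegativeCycle : ∀ {m k} → CostMatrix m k → Allotment m k → Set
NoNegativeCycle CM A = ∀ C → IsSimpleCycle A C → Data.Integer._≤_ 0ℤ (pathCost CM C)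

-- Performing the transfers of all edges of a list (each edge (s_p,s_q,d)
-- replaces ⟨d,s_p⟩ by ⟨d,s_q⟩; for a simple cycle the demand units are distinct).
performTransfers : ∀ {m k} → List (Edge m k) → Allotment m k → Allotment m k
performTransfers [] A = A
performTransfers (e ∷ es) A d = if does (d ≟ dem e) then just (head e) else performTransfers es A d

step : ∀ {m k} → CostMatrix m k → List (Edge m k) → Allotment m k → Allotment m k
step CM C A = if does (pathCost CM C <? 0ℤ) then performTransfers C A else A

-- A simple cycle of Γ(A2) that avoids the new demand dᵢ is a cycle of Γ(A1), hence
-- nonnegative; one that uses dᵢ passes through sⱼ, hence costs at least cost(Cmin). This
-- settles the case cost(Cmin) ≥ 0. Otherwise put M = −cost(Cmin) and charge every transfer
-- of dᵢ an extra M. Under these penalised costs every simple cycle of Γ(A2), and so every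
-- closed walk, is nonnegative, while Cmin (which uses dᵢ exactly once, all dᵢ-edges leaving
-- sⱼ) costs exactly 0. An edge of Γ(A3) moving a demand untouched by Cmin is an edge of
-- Γ(A2); one moving the demand of an edge e of Cmin is simulated in Γ(A2) by going around
-- the rest of Cmin from head e back to tail e and then transferring directly, which is no
-- dearer. A negative cycle of Γ(A3) would thus give a negative closed walk in Γ(A2).
module Submission where

open import Defs
open import Data.Nat using (ℕ; _<_)
open import Data.Fin using (Fin)
open import Data.Maybe using (nothing)
open import Data.List using (List)
open import Data.Integer using (_≤_)
open import Relation.Binary.PropositionalEquality using (_≡_)

open import Function using (_∘_)
open import Data.Fin using (_≟_)
open import Data.Maybe using (just)
open import Data.Maybe.Properties using (just-injective)
import Data.Integer as ℤ
open import Data.Integer using (ℤ; 0ℤ; _+_; _-_; -_; _<?_) renaming (_<_ to _<ℤ_)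
open import Data.Integer.Properties
  using (≤-refl; ≤-reflexive; ≤-trans; +-mono-≤; +-monoˡ-≤; +-monoʳ-≤; ≮⇒≥; <⇒≤; <⇒≱;
         neg-mono-<; +-identityˡ; +-identityʳ; +-inverseʳ; +-assoc; +-commutativeSemigroup;
         module ≤-Reasoning)
open import Data.Integer.Tactic.RingSolver using (solve-∀)
open import Algebra.Properties.CommutativeSemigroup +-commutativeSemigroup using (interchange)
open import Data.List using ([]; _∷_; _++_; foldr; map)
open import Data.List.Relation.Unary.Unique.Propositional using (Unique)
open import Data.List.Membership.Propositional using (find)
open import Data.List.Membership.Propositional.Properties using (∈-∃++)
open import Data.List.Relation.Unary.All as All using (All; []; _∷_)
open import Data.List.Relation.Unary.All.Properties using (¬Any⇒All¬; All¬⇒¬Any; ++⁺; ++⁻ˡ; ++⁻ʳ)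
open import Data.List.Relation.Unary.Any using (Any; here; there; any?)
open import Data.List.Relation.Unary.AllPairs using (AllPairs; []; _∷_)
import Data.List.Relation.Unary.AllPairs.Properties as AllPairs
open import Data.Product using (Σ; ∃-syntax; _×_; _,_; proj₁)
open import Data.Empty using (⊥-elim)
open import Data.Bool using (if_then_else_)
open import Relation.Nullary using (Dec; yes; no; does)
open import Relation.Nullary.Decidable using (dec-true; dec-false)
open import Relation.Binary.PropositionalEquality
  using (_≢_; refl; sym; trans; cong; cong₂; subst; ≢-sym)

allPairs-++⁻ : ∀ {a r} {X : Set a} {R : X → X → Set r} xs {ys} → AllPairs R (xs ++ ys) →
               AllPairs R xs × AllPairs R ys × All (λ x → All (R x) ys) xs
allPairs-++⁻ []       Rys         = [] , Rys , []
allPairs-++⁻ (x ∷ xs) (Rx ∷ Rxys) with Rxs , Rys , cross ← allPairs-++⁻ xs Rxys =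
  ++⁻ˡ xs Rx ∷ Rxs , Rys , ++⁻ʳ xs Rx ∷ cross

≤-+-nonnegˡ : ∀ {i} j → 0ℤ ≤ i → j ≤ i + j
≤-+-nonnegˡ {i} j 0≤i = subst (_≤ i + j) (+-identityˡ j) (+-monoˡ-≤ j 0≤i)

≤-+-nonnegʳ : ∀ i {j} → 0ℤ ≤ j → i ≤ i + j
≤-+-nonnegʳ i {j} 0≤j = subst (_≤ i + j) (+-identityʳ i) (+-monoʳ-≤ i 0≤j)

module _ {m k : ℕ} where

  weight : (Edge m k → ℤ) → List (Edge m k) → ℤ
  weight w = foldr (λ e z → w e + z) 0ℤ

  weight-++ : ∀ w xs ys → weight w (xs ++ ys) ≡ weight w xs + weight w ys
  weight-++ w []       ys = sym (+-identityˡ _)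
  weight-++ w (x ∷ xs) ys = trans (cong (w x +_) (weight-++ w xs ys)) (sym (+-assoc (w x) _ _))

  weight-+ : ∀ v w xs → weight (λ e → v e + w e) xs ≡ weight v xs + weight w xs
  weight-+ v w []       = refl
  weight-+ v w (x ∷ xs) = trans (cong (v x + w x +_) (weight-+ v w xs)) (interchange (v x) (w x) _ _)

  walk-++⁺ : ∀ xs {ys : List (Edge m k)} {u v x} →
             IsWalk u xs v → IsWalk v ys x → IsWalk u (xs ++ ys) x
  walk-++⁺ []       refl         walk-ys = walk-ys
  walk-++⁺ (e ∷ xs) (t≡u , walk) walk-ys = t≡u , walk-++⁺ xs walk walk-ys

  walk-++⁻ : ∀ xs {ys : List (Edge m k)} {u x} →
             IsWalk u (xs ++ ys) x → ∃[ v ] IsWalk u xs v × IsWalk v ys x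
  walk-++⁻ []       walk = _ , refl , walk
  walk-++⁻ (e ∷ xs) (t≡u , walk) with v , walk-xs , walk-ys ← walk-++⁻ xs walk =
    v , (t≡u , walk-xs) , walk-ys

  DistinctTails : List (Edge m k) → Set
  DistinctTails = AllPairs (λ e f → tail e ≢ tail f)

  distinctTails⇒unique : ∀ {C} → DistinctTails C → Unique (map tail C)
  distinctTails⇒unique = AllPairs.map⁺

  unique⇒distinctTails : ∀ {C} → Unique (map tail C) → DistinctTails C
  unique⇒distinctTails = AllPairs.map⁻

  DistinctDemands : List (Edge m k) → Set
  DistinctDemands = AllPairs (λ e f → dem e ≢ dem f)

module _ {m k : ℕ} {A : Allotment m k} where

  cycle-edges : ∀ {C} → IsSimpleCycle A C → All (IsEdge A) C
  cycle-edges {_ ∷ _} (edges , _ , _) = edges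

  cycle-closed : ∀ {C} → IsSimpleCycle A C → ∃[ s ] IsWalk s C s
  cycle-closed {_ ∷ _} (_ , walk , _) = _ , walk

  cycle-distinctTails : ∀ {C} → IsSimpleCycle A C → DistinctTails C
  cycle-distinctTails {_ ∷ _} (_ , _ , unique) = unique⇒distinctTails unique

  -- In Γ(A) the tail of an edge is the centre its demand is allotted to.
  edges-distinctDemands : ∀ {C} → All (IsEdge A) C → DistinctTails C → DistinctDemands C
  edges-distinctDemands []               []                = []
  edges-distinctDemands {e ∷ _} (e∈Γ ∷ C⊆Γ) (e≢C ∷ distinct) =
    All.zipWith (λ (f∈Γ , te≢tf) de≡df → te≢tf (sameTail f∈Γ de≡df)) (C⊆Γ , e≢C)
      ∷ edges-distinctDemands C⊆Γ distinct
    where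
    sameTail : ∀ {f} → IsEdge A f → dem e ≡ dem f → tail e ≡ tail f
    sameTail f∈Γ de≡df =
      just-injective (trans (sym (proj₁ e∈Γ)) (trans (cong A de≡df) (proj₁ f∈Γ)))

  record CheapWalk (w : Edge m k → ℤ) (u v : Fin k) (bound : ℤ) : Set where
    constructor cheapWalk
    field
      route   : List (Edge m k)
      inΓ     : All (IsEdge A) route
      isWalk  : IsWalk u route v
      bounded : weight w route ≤ bound
  open CheapWalk

  cheapWalk-++ : ∀ {w u v x b c} → CheapWalk w u v b → CheapWalk w v x c → CheapWalk w u x (b + c)
  cheapWalk-++ {w} (cheapWalk R R⊆Γ walk-R R≤b) (cheapWalk S S⊆Γ walk-S S≤c) =
    cheapWalk (R ++ S) (++⁺ R⊆Γ S⊆Γ) (walk-++⁺ R walk-R walk-S)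
      (subst (_≤ _) (sym (weight-++ w R S)) (+-mono-≤ R≤b S≤c))

  cheapWalk-weaken : ∀ {w u v b c} → b ≤ c → CheapWalk w u v b → CheapWalk w u v c
  cheapWalk-weaken b≤c (cheapWalk R R⊆Γ walk-R R≤b) = cheapWalk R R⊆Γ walk-R (≤-trans R≤b b≤c)

  closedWalk-rotate : ∀ {w s} xs e ys → All (IsEdge A) (xs ++ e ∷ ys) → IsWalk s (xs ++ e ∷ ys) s →
                      CheapWalk w (head e) (tail e) (weight w ys + weight w xs)
  closedWalk-rotate {w} xs e ys C⊆Γ walk with _ , walk-xs , (te≡v , walk-ys) ← walk-++⁻ xs walk =
    cheapWalk (ys ++ xs) (++⁺ (All.tail (++⁻ʳ xs C⊆Γ)) (++⁻ˡ xs C⊆Γ))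
      (walk-++⁺ ys walk-ys (subst (IsWalk _ xs) (sym te≡v) walk-xs))
      (≤-reflexive (weight-++ w ys xs))

  module _ (w : Edge m k → ℤ) (cycles-nonneg : ∀ C → IsSimpleCycle A C → 0ℤ ≤ weight w C) where

    -- Prepending an edge to a path either keeps the tails distinct or closes a simple
    -- cycle, which can be cut out without increasing the weight.
    shortcut : ∀ W {u v} → All (IsEdge A) W → IsWalk u W v →
               Σ (CheapWalk w u v (weight w W)) (DistinctTails ∘ route)
    shortcut []      []           u≡v             = cheapWalk [] [] u≡v ≤-refl , []
    shortcut (e ∷ W) (e∈Γ ∷ W⊆Γ) (refl , walk-W)
      with cheapWalk Q Q⊆Γ walk-Q Q≤W , distinct ← shortcut W W⊆Γ walk-W
      with any? (λ b → tail b ≟ tail e) Q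
    ... | no te∉Q =
      cheapWalk (e ∷ Q) (e∈Γ ∷ Q⊆Γ) (refl , walk-Q) (+-monoʳ-≤ (w e) Q≤W) ,
      (All.map ≢-sym (¬Any⇒All¬ Q te∉Q) ∷ distinct)
    ... | yes te∈Q
      with b , b∈Q , tb≡te ← find te∈Q
      with as , bs , refl ← ∈-∃++ b∈Q
      with _ , walk-as , (tb≡v , walk-bs) ← walk-++⁻ as walk-Q
      with distinct-as , distinct-bs , as≢bs ← allPairs-++⁻ as distinct =
      cheapWalk (b ∷ bs) (++⁻ʳ as Q⊆Γ) (tb≡te , walk-bs) bs≤W , distinct-bs
      where
      te≢ta : ∀ {a : Edge m k} → All (λ c → tail a ≢ tail c) (b ∷ bs) → tail e ≢ tail a
      te≢ta {a} ta≢bs = ≢-sym (subst (tail a ≢_) tb≡te (All.head ta≢bs))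
      loop : IsSimpleCycle A (e ∷ as)
      loop = e∈Γ ∷ ++⁻ˡ as Q⊆Γ
           , (refl , subst (IsWalk (head e) as) (trans (sym tb≡v) tb≡te) walk-as)
           , distinctTails⇒unique {C = e ∷ as} (All.map (λ {a} → te≢ta {a}) as≢bs ∷ distinct-as)
      bs≤W : weight w (b ∷ bs) ≤ w e + weight w W
      bs≤W = begin
        weight w (b ∷ bs)                         ≤⟨ ≤-+-nonnegˡ _ (cycles-nonneg (e ∷ as) loop) ⟩
        weight w (e ∷ as) + weight w (b ∷ bs)     ≡⟨ +-assoc (w e) _ _ ⟩
        w e + (weight w as + weight w (b ∷ bs))   ≡⟨ cong (w e +_) (sym (weight-++ w as (b ∷ bs))) ⟩
        w e + weight w (as ++ b ∷ bs)             ≤⟨ +-monoʳ-≤ (w e) Q≤W ⟩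
        w e + weight w W                          ∎
        where open ≤-Reasoning

    closedWalk-nonneg : ∀ W {s} → All (IsEdge A) W → IsWalk s W s → 0ℤ ≤ weight w W
    closedWalk-nonneg W W⊆Γ walk with shortcut W W⊆Γ walk
    ... | cheapWalk []      _   _               Q≤W , _        = Q≤W
    ... | cheapWalk (q ∷ Q) Q⊆Γ (tq≡s , walk-Q) Q≤W , distinct =
      ≤-trans (cycles-nonneg (q ∷ Q) cycle) Q≤W
      where
      cycle : IsSimpleCycle A (q ∷ Q)
      cycle = Q⊆Γ
            , (refl , subst (IsWalk (head q) Q) (sym tq≡s) walk-Q)
            , distinctTails⇒unique {C = q ∷ Q} distinct

module _ {m k : ℕ} {A B : Allotment m k} (w : Edge m k → ℤ) where

  simulate : ∀ {c : Edge m k → ℤ} →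
             (∀ {f} → IsEdge B f → CheapWalk {A = A} w (tail f) (head f) (c f)) →
             ∀ C {u v} → All (IsEdge B) C → IsWalk u C v → CheapWalk {A = A} w u v (weight c C)
  simulate detour []      []          u≡v            = cheapWalk [] [] u≡v ≤-refl
  simulate detour (f ∷ C) (f∈Γ ∷ C⊆Γ) (refl , walk-C) =
    cheapWalk-++ (detour f∈Γ) (simulate detour C C⊆Γ walk-C)

  noNegativeCycle-by-detours : (CM : CostMatrix m k) → (∀ C → IsSimpleCycle A C → 0ℤ ≤ weight w C) →
    (∀ {f} → IsEdge B f → CheapWalk {A = A} w (tail f) (head f) (edgeCost CM f)) → NoNegativeCycle CM B
  noNegativeCycle-by-detours CM cycles-nonneg detour (f ∷ C) (C⊆Γ , walk , _)
    with cheapWalk W W⊆Γ walk-W W≤C ← simulate detour (f ∷ C) C⊆Γ walk =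
    ≤-trans (closedWalk-nonneg w cycles-nonneg W W⊆Γ walk-W) W≤C

module _ {m k : ℕ} {A : Allotment m k} {d : Fin m} {s : Fin k} where

  extend-≡ : extend A d s d ≡ just s
  extend-≡ rewrite dec-true (d ≟ d) refl = refl

  extend-≢ : ∀ {d'} → d' ≢ d → extend A d s d' ≡ A d'
  extend-≢ {d'} d'≢d rewrite dec-false (d' ≟ d) d'≢d = refl

  isEdge-extend⁻ : ∀ {e} → IsEdge (extend A d s) e → dem e ≢ d → IsEdge A e
  isEdge-extend⁻ (allotted , h≢t) e≢d = trans (sym (extend-≢ e≢d)) allotted , h≢t

  tail-extend : ∀ {e} → IsEdge (extend A d s) e → dem e ≡ d → tail e ≡ s
  tail-extend {e} (allotted , _) e≡d =
    just-injective (trans (sym allotted) (trans (cong (extend A d s) e≡d) extend-≡))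

  simpleCycle-extend⁻ : ∀ {C} → IsSimpleCycle (extend A d s) C → All (λ e → dem e ≢ d) C →
                        IsSimpleCycle A C
  simpleCycle-extend⁻ {_ ∷ _} (C⊆Γ , walk , unique) avoids =
    All.zipWith (λ (e∈Γ , e≢d) → isEdge-extend⁻ e∈Γ e≢d) (C⊆Γ , avoids) , walk , unique

  passesThrough-extend : ∀ {C} → All (IsEdge (extend A d s)) C → Any (λ e → dem e ≡ d) C →
                         PassesThrough s C
  passesThrough-extend (e∈Γ ∷ _)   (here e≡d)  = here (tail-extend e∈Γ e≡d)
  passesThrough-extend (_   ∷ C⊆Γ) (there uses) = there (passesThrough-extend C⊆Γ uses)

data TransferView {m k : ℕ} (C : List (Edge m k)) (A : Allotment m k) (d : Fin m) : Set where
  untouched : All (λ e → dem e ≢ d) C → performTransfers C A d ≡ A d → TransferView C A d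
  moved     : ∀ xs e ys → C ≡ xs ++ e ∷ ys → dem e ≡ d → performTransfers C A d ≡ just (head e) →
              TransferView C A d

module _ {m k : ℕ} (e : Edge m k) (C : List (Edge m k)) (A : Allotment m k) {d : Fin m} where

  performTransfers-here : d ≡ dem e → performTransfers (e ∷ C) A d ≡ just (head e)
  performTransfers-here d≡e rewrite dec-true (d ≟ dem e) d≡e = refl

  performTransfers-there : d ≢ dem e → performTransfers (e ∷ C) A d ≡ performTransfers C A d
  performTransfers-there d≢e rewrite dec-false (d ≟ dem e) d≢e = refl

transferView : ∀ {m k : ℕ} C (A : Allotment m k) d → TransferView C A d
transferView []      A d = untouched [] refl
transferView (e ∷ C) A d with d ≟ dem e
... | yes d≡e = moved [] e C refl (sym d≡e) (performTransfers-here e C A d≡e)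
... | no d≢e with transferView C A d
...   | untouched avoids unchanged =
  untouched (≢-sym d≢e ∷ avoids) (trans (performTransfers-there e C A d≢e) unchanged)
...   | moved xs f ys refl f≡d moved-to =
  moved (e ∷ xs) f ys refl f≡d (trans (performTransfers-there e C A d≢e) moved-to)

module Penalty {m k : ℕ} (CM : CostMatrix m k) (d : Fin m) {M : ℤ} (0≤M : 0ℤ ≤ M) where

  penalty : Fin m → ℤ
  penalty d' with d' ≟ d
  ... | yes _ = M
  ... | no  _ = 0ℤ

  penalisedCost : Edge m k → ℤ
  penalisedCost e = edgeCost CM e + penalty (dem e)

  penalty-nonneg : ∀ d' → 0ℤ ≤ penalty d'
  penalty-nonneg d' with d' ≟ d
  ... | yes _ = 0≤M
  ... | no  _ = ≤-refl

  penalty-≡ : ∀ {d'} → d' ≡ d → penalty d' ≡ M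
  penalty-≡ {d'} d'≡d with d' ≟ d
  ... | yes _    = refl
  ... | no d'≢d = ⊥-elim (d'≢d d'≡d)

  penalty-≢ : ∀ {d'} → d' ≢ d → penalty d' ≡ 0ℤ
  penalty-≢ {d'} d'≢d with d' ≟ d
  ... | yes d'≡d = ⊥-elim (d'≢d d'≡d)
  ... | no  _    = refl

  penalties : List (Edge m k) → ℤ
  penalties = weight (penalty ∘ dem)

  weight-penalised : ∀ C → weight penalisedCost C ≡ pathCost CM C + penalties C
  weight-penalised = weight-+ (edgeCost CM) (penalty ∘ dem)

  penalties-nonneg : ∀ C → 0ℤ ≤ penalties C
  penalties-nonneg []      = ≤-refl
  penalties-nonneg (e ∷ C) = +-mono-≤ (penalty-nonneg (dem e)) (penalties-nonneg C)

  penalties-avoiding : ∀ {C} → All (λ e → dem e ≢ d) C → penalties C ≡ 0ℤ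
  penalties-avoiding {[]} []                 = refl
  penalties-avoiding {_ ∷ C} (e≢d ∷ avoids) =
    cong₂ _+_ (penalty-≢ e≢d) (penalties-avoiding {C} avoids)

  penalties-using : ∀ {C} → Any (λ e → dem e ≡ d) C → M ≤ penalties C
  penalties-using {e ∷ C} (here e≡d) =
    subst (λ p → M ≤ p + penalties C) (sym (penalty-≡ e≡d)) (≤-+-nonnegʳ M (penalties-nonneg C))
  penalties-using {e ∷ C} (there uses) =
    ≤-trans (penalties-using uses) (≤-+-nonnegˡ _ (penalty-nonneg (dem e)))

  penalties-once : ∀ {C} → DistinctDemands C → penalties C ≤ M
  penalties-once []                 = 0≤M
  penalties-once {e ∷ C} (e≢C ∷ distinct) with dem e ≟ d
  ... | yes e≡d = ≤-reflexive (trans (cong (M +_) (penalties-avoiding others-avoid)) (+-identityʳ M))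
    where
    others-avoid : All (λ f → dem f ≢ d) C
    others-avoid = All.map (λ e≢f f≡d → e≢f (trans e≡d (sym f≡d))) e≢C
  ... | no  _   = subst (_≤ M) (sym (+-identityˡ _)) (penalties-once distinct)

  module _ {A : Allotment m k} where

    -- For v ≡ u the edge does not exist, and the empty walk is used instead.
    hop : ∀ {d' u} → A d' ≡ just u → ∀ v →
          CheapWalk {A = A} penalisedCost u v (penalisedCost (edge u v d'))
    hop {d'} {u} allotted v with v ≟ u
    ... | yes refl = cheapWalk [] [] refl (subst (0ℤ ≤_) (sym loop-cost) (penalty-nonneg d'))
      where
      loop-cost : penalisedCost (edge u u d') ≡ penalty d'
      loop-cost = trans (cong (_+ penalty d') (+-inverseʳ (ℤ.+ CM d' u))) (+-identityˡ _)
    ... | no v≢u =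
      cheapWalk (edge u v d' ∷ []) ((allotted , v≢u) ∷ []) (refl , refl) (≤-reflexive (+-identityʳ _))

    transfer-detour : ∀ {s} C → All (IsEdge A) C → IsWalk s C s → Any (λ e → dem e ≡ d) C →
      weight penalisedCost C ≤ 0ℤ →
      ∀ {f} → IsEdge (performTransfers C A) f →
      CheapWalk {A = A} penalisedCost (tail f) (head f) (edgeCost CM f)
    transfer-detour C C⊆Γ walk uses C≤0 {edge tf hf df} (allotted , hf≢tf) with transferView C A df
    ... | untouched avoids unchanged =
      cheapWalk (edge tf hf df ∷ []) ((trans (sym unchanged) allotted , hf≢tf) ∷ []) (refl , refl)
        (≤-reflexive (trans (+-identityʳ _)
          (trans (cong (edgeCost CM (edge tf hf df) +_) (penalty-≢ df≢d)) (+-identityʳ _))))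
      where
      df≢d : df ≢ d
      df≢d refl = All¬⇒¬Any avoids uses
    ... | moved xs (edge te he _) ys refl refl moved-to
      with refl ← just-injective (trans (sym moved-to) allotted) =
      cheapWalk-weaken bound
        (cheapWalk-++ (closedWalk-rotate xs (edge te he df) ys C⊆Γ walk)
                      (hop (proj₁ (All.head (++⁻ʳ xs C⊆Γ))) hf))
      where
      bound : (weight penalisedCost ys + weight penalisedCost xs) + penalisedCost (edge te hf df)
              ≤ edgeCost CM (edge he hf df)
      bound = begin
        (Y + X) + ((c - a) + p)               ≡⟨ rearrange X Y a b c p ⟩
        (X + (((b - a) + p) + Y)) + (c - b)   ≡⟨ cong (_+ (c - b)) (sym (weight-++ penalisedCost xs _)) ⟩
        weight penalisedCost C' + (c - b)     ≤⟨ +-monoˡ-≤ (c - b) C≤0 ⟩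
        0ℤ + (c - b)                          ≡⟨ +-identityˡ (c - b) ⟩
        c - b                                 ∎
        where
        open ≤-Reasoning
        C' = xs ++ edge te he df ∷ ys
        X = weight penalisedCost xs
        Y = weight penalisedCost ys
        a = ℤ.+ CM df te
        b = ℤ.+ CM df he
        c = ℤ.+ CM df hf
        p = penalty df
        rearrange : ∀ X Y a b c p → (Y + X) + ((c - a) + p) ≡ (X + (((b - a) + p) + Y)) + (c - b)
        rearrange = solve-∀

module Extension {m k : ℕ} (CM : CostMatrix m k) {A : Allotment m k} (noNegative : NoNegativeCycle CM A)
                 (d : Fin m) (s : Fin k) where

  A⁺ : Allotment m k
  A⁺ = extend A d s

  cycle-avoiding : ∀ {C} → IsSimpleCycle A⁺ C → All (λ e → dem e ≢ d) C → 0ℤ ≤ pathCost CM C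
  cycle-avoiding cycle avoids = noNegative _ (simpleCycle-extend⁻ cycle avoids)

  extend-noNegativeCycle : (∀ C → IsSimpleCycle A⁺ C → PassesThrough s C → 0ℤ ≤ pathCost CM C) →
                           NoNegativeCycle CM A⁺
  extend-noNegativeCycle through C cycle with any? (λ e → dem e ≟ d) C
  ... | yes uses  = through C cycle (passesThrough-extend (cycle-edges cycle) uses)
  ... | no avoids = cycle-avoiding cycle (¬Any⇒All¬ C avoids)

  negativeCycle-uses : ∀ {C} → IsSimpleCycle A⁺ C → pathCost CM C <ℤ 0ℤ →
                       Any (λ e → dem e ≡ d) C
  negativeCycle-uses {C} cycle negative with any? (λ e → dem e ≟ d) C
  ... | yes uses  = uses
  ... | no avoids = ⊥-elim (<⇒≱ negative (cycle-avoiding cycle (¬Any⇒All¬ C avoids)))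

  module _ {M : ℤ} (0≤M : 0ℤ ≤ M) where
    open Penalty CM d 0≤M

    penalised-cycle-nonneg :
      (∀ C → IsSimpleCycle A⁺ C → PassesThrough s C → 0ℤ ≤ pathCost CM C + M) →
      ∀ C → IsSimpleCycle A⁺ C → 0ℤ ≤ weight penalisedCost C
    penalised-cycle-nonneg through C cycle with any? (λ e → dem e ≟ d) C
    ... | yes uses =
      ≤-trans (through C cycle (passesThrough-extend (cycle-edges cycle) uses))
        (subst (pathCost CM C + M ≤_) (sym (weight-penalised C))
               (+-monoʳ-≤ (pathCost CM C) (penalties-using uses)))
    ... | no avoids = subst (0ℤ ≤_) (sym unpenalised) (cycle-avoiding cycle (¬Any⇒All¬ C avoids))
      where
      unpenalised : weight penalisedCost C ≡ pathCost CM C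
      unpenalised = trans (weight-penalised C)
        (trans (cong (pathCost CM C +_) (penalties-avoiding (¬Any⇒All¬ C avoids))) (+-identityʳ _))

    penalised-cycle-bounded : ∀ {C} → IsSimpleCycle A⁺ C → weight penalisedCost C ≤ pathCost CM C + M
    penalised-cycle-bounded {C} cycle = subst (_≤ _) (sym (weight-penalised C))
      (+-monoʳ-≤ (pathCost CM C)
        (penalties-once (edges-distinctDemands (cycle-edges cycle) (cycle-distinctTails cycle))))

  transfer-noNegativeCycle : ∀ {Cmin} → IsSimpleCycle A⁺ Cmin →
    (∀ C → IsSimpleCycle A⁺ C → PassesThrough s C → pathCost CM Cmin ≤ pathCost CM C) →
    pathCost CM Cmin <ℤ 0ℤ → NoNegativeCycle CM (performTransfers Cmin A⁺)
  transfer-noNegativeCycle {Cmin} Cmin-cycle minimal negative with _ , walk ← cycle-closed Cmin-cycle =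
    noNegativeCycle-by-detours penalisedCost CM (penalised-cycle-nonneg 0≤M through)
      (transfer-detour Cmin (cycle-edges Cmin-cycle) walk (negativeCycle-uses Cmin-cycle negative) Cmin≤0)
    where
    M : ℤ
    M = - pathCost CM Cmin
    0≤M : 0ℤ ≤ M
    0≤M = <⇒≤ (neg-mono-< negative)
    open Penalty CM d 0≤M
    balanced : pathCost CM Cmin + M ≡ 0ℤ
    balanced = +-inverseʳ (pathCost CM Cmin)
    through : ∀ C → IsSimpleCycle A⁺ C → PassesThrough s C → 0ℤ ≤ pathCost CM C + M
    through C cycle passes =
      subst (_≤ pathCost CM C + M) balanced (+-monoˡ-≤ M (minimal C cycle passes))
    Cmin≤0 : weight penalisedCost Cmin ≤ 0ℤ
    Cmin≤0 = subst (weight penalisedCost Cmin ≤_) balanced (penalised-cycle-bounded 0≤M Cmin-cycle)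

step-cases : ∀ {m k} (CM : CostMatrix m k) C A (P : Allotment m k → Set) →
  (pathCost CM C <ℤ 0ℤ → P (performTransfers C A)) → (0ℤ ≤ pathCost CM C → P A) → P (step CM C A)
step-cases CM C A P negative nonnegative = decide (pathCost CM C <? 0ℤ)
  where
  decide : (negative? : Dec (pathCost CM C <ℤ 0ℤ)) →
           P (if does negative? then performTransfers C A else A)
  decide (yes neg) = negative neg
  decide (no ¬neg) = nonnegative (≮⇒≥ ¬neg)

lemma4p1 : (m k : ℕ) (CM : CostMatrix m k) → (∀ d s → 0 < CM d s) →
    (A1 : Allotment m k) → NoNegativeCycle CM A1 →
    (di : Fin m) → A1 di ≡ nothing → (sj : Fin k) →
    (Cmin : List (Edge m k)) →
    IsSimpleCycle (extend A1 di sj) Cmin → PassesThrough sj Cmin →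
    (∀ C → IsSimpleCycle (extend A1 di sj) C → PassesThrough sj C →
      pathCost CM Cmin ≤ pathCost CM C) →
    NoNegativeCycle CM (step CM Cmin (extend A1 di sj))
lemma4p1 m k CM _ A1 noNegative di _ sj Cmin Cmin-cycle _ minimal =
  step-cases CM Cmin (extend A1 di sj) (NoNegativeCycle CM)
    (transfer-noNegativeCycle Cmin-cycle minimal)
    (λ 0≤Cmin → extend-noNegativeCycle (λ C cycle passes → ≤-trans 0≤Cmin (minimal C cycle passes)))
  where open Extension CM noNegative di sj
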